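{- The assignments $Q\mapsto\Delta Q$ (endomonads on $\mathbf{Set}$ to relative monads on $\Delta$) and $P\mapsto\bar P$ (relative monads on $\Delta$ to endomonads on $\mathbf{Set}$) give rise to an adjunction between the category of endomonads on $\mathbf{Set}$ and the category $\mathrm{RMon}(\Delta)$ of relative monads on $\Delta$: there are bijections, natural in an endomonad $P$ and a monad $Q$ on $\Delta$, $$\mathrm{Hom}(\Delta P,Q)\cong\mathrm{Hom}(P,\bar Q).$$
   Context: $\Delta:\mathbf{Set}\to\mathbf{PO}$ sends $X$ to $(X,=)$ and is left adjoint to the forgetful functor $U:\mathbf{PO}\to\mathbf{Set}$, via bijections $a_{X,Y}:\mathbf{PO}(\Delta X,Y)\cong\mathbf{Set}(X,UY)$. A relative monad $P$ on a functor $F:\mathcal C\to\mathcal D$ consists of an object map $P$, morphisms $\eta_c\in\mathcal D(Fc,Pc)$ and maps $\sigma_{c,d}:\mathcal D(Fc,Pd)\to\mathcal D(Pc,Pd)$ with $\sigma(f)\circ\eta_c=f$, $\sigma(\eta_c)=\mathrm{id}$, $\sigma(g)\circ\sigma(f)=\sigma(\sigma(g)\circ f)$. A morphism $\tau:P\to Q$ of relative monads is a family $\tau_c\in\mathcal D(Pc,Qc)$ with $\tau_d\circ\sigma^P(f)=\sigma^Q(\tau_d\circ f)\circ\tau_c$ and $\tau_c\circ\eta^P_c=\eta^Q_c$. Endomonads on $\mathbf{Set}$ are relative monads on $\mathrm{Id}_{\mathbf{Set}}$, with the same notion of morphism. For a monad $P$ on $\Delta$, $\bar P$ is the endomonad with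 object map $X\mapsto U(PX)$, unit $U(\eta_X)$ and substitution $\sigma^{\bar P}(f):=U(\sigma(a^{ -1}(f)))$ for $f\in\mathbf{Set}(X,UPY)$. For an endomonad $Q$, $\Delta Q$ is the monad on $\Delta$ with object map $X\mapsto\Delta(QX)$, unit $\eta^Q_X$, and substitution $\sigma^{\Delta Q}(f):=\Delta(\sigma^Q(a(f)))$ for $f\in\mathbf{PO}(\Delta X,\Delta QY)$. -}

module Defs where

open import Relation.Binary.PropositionalEquality
  using (_≡_; refl; sym; trans; cong; _≗_)
open import Function using (_∘_; id)

record PO : Set₁ where
  field
    Car    : Set
    _≤_    : Car → Car → Set
    ≤-refl : ∀ {x} → x ≤ x
    ≤-trans : ∀ {x y z} → x ≤ y → y ≤ z → x ≤ z

record _⇒_ (A B : PO) : Set where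
  field
    fun  : PO.Car A → PO.Car B
    mono : ∀ {x y} → PO._≤_ A x y → PO._≤_ B (fun x) (fun y)
open _⇒_ public

infixr 9 _∘P_
infix 4 _≈_

_≈_ : ∀ {A B} → (f g : A ⇒ B) → Set
f ≈ g = ∀ x → fun f x ≡ fun g x

idP : ∀ {A} → A ⇒ A
idP = record { fun = λ x → x ; mono = λ p → p }

_∘P_ : ∀ {A B C} → B ⇒ C → A ⇒ B → A ⇒ C
g ∘P f = record { fun = λ x → fun g (fun f x) ; mono = λ p → mono g (mono f p) }

U : PO → Set
U = PO.Car

Δ : Set → PO
Δ X = record { Car = X ; _≤_ = _≡_ ; ≤-refl = refl ; ≤-trans = trans }

Δ₁ : ∀ {X Y} → (X → Y) → Δ X ⇒ Δ Y
Δ₁ f = record { fun = f ; mono = cong f }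

a : ∀ {X Y} → Δ X ⇒ Y → (X → U Y)
a f = fun f

a⁻¹ : ∀ {X Y} → (X → U Y) → Δ X ⇒ Y
a⁻¹ {X} {Y} f = record { fun = f ; mono = λ { refl → PO.≤-refl Y } }

record ΔMonad : Set₁ where
  field
    T   : Set → PO
    η   : ∀ {X} → Δ X ⇒ T X
    σ   : ∀ {X Y} → Δ X ⇒ T Y → T X ⇒ T Y
    -- σ is a function on hom-sets, i.e. respects equality of morphisms
    σ-cong : ∀ {X Y} {f g : Δ X ⇒ T Y} → f ≈ g → σ f ≈ σ g
    σ-η : ∀ {X Y} (f : Δ X ⇒ T Y) → σ f ∘P η ≈ f
    η-σ : ∀ {X} → σ (η {X}) ≈ idP
    σ-σ : ∀ {X Y Z} (f : Δ X ⇒ T Y) (g : Δ Y ⇒ T Z) →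
          σ g ∘P σ f ≈ σ (σ g ∘P f)

record ΔMonadHom (P Q : ΔMonad) : Set₁ where
  private
    module P = ΔMonad P
    module Q = ΔMonad Q
  field
    τ   : ∀ X → P.T X ⇒ Q.T X
    τ-σ : ∀ {X Y} (f : Δ X ⇒ P.T Y) → τ Y ∘P P.σ f ≈ Q.σ (τ Y ∘P f) ∘P τ X
    τ-η : ∀ X → τ X ∘P P.η ≈ Q.η

_≈Δ_ : ∀ {P Q} → (α β : ΔMonadHom P Q) → Set₁
α ≈Δ β = ∀ X → ΔMonadHom.τ α X ≈ ΔMonadHom.τ β X

record EndoMonad : Set₁ where
  field
    T   : Set → Set
    η   : ∀ {X} → X → T X
    σ   : ∀ {X Y} → (X → T Y) → T X → T Y
    σ-cong : ∀ {X Y} {f g : X → T Y} → f ≗ g → σ f ≗ σ g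
    σ-η : ∀ {X Y} (f : X → T Y) → σ f ∘ η ≗ f
    η-σ : ∀ {X} → σ (η {X}) ≗ id
    σ-σ : ∀ {X Y Z} (f : X → T Y) (g : Y → T Z) →
          σ g ∘ σ f ≗ σ (σ g ∘ f)

record EndoHom (P Q : EndoMonad) : Set₁ where
  private
    module P = EndoMonad P
    module Q = EndoMonad Q
  field
    τ   : ∀ X → P.T X → Q.T X
    τ-σ : ∀ {X Y} (f : X → P.T Y) → τ Y ∘ P.σ f ≗ Q.σ (τ Y ∘ f) ∘ τ X
    τ-η : ∀ X → τ X ∘ P.η ≗ Q.η

_≈E_ : ∀ {P Q} → (α β : EndoHom P Q) → Set₁
α ≈E β = ∀ X → EndoHom.τ α X ≗ EndoHom.τ β X

_∘E_ : ∀ {P Q R} → EndoHom Q R → EndoHom P Q → EndoHom P R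
_∘E_ {P} {Q} {R} β α = record
  { τ = λ X x → β.τ X (α.τ X x)
  ; τ-σ = λ {X} {Y} f x →
      trans (cong (β.τ Y) (α.τ-σ f x)) (β.τ-σ (α.τ Y ∘ f) (α.τ X x))
  ; τ-η = λ X x → trans (cong (β.τ X) (α.τ-η X x)) (β.τ-η X x)
  }
  where module α = EndoHom α
        module β = EndoHom β

_∘Δ_ : ∀ {P Q R} → ΔMonadHom Q R → ΔMonadHom P Q → ΔMonadHom P R
_∘Δ_ {P} {Q} {R} β α = record
  { τ = λ X → β.τ X ∘P α.τ X
  ; τ-σ = λ {X} {Y} f x →
      trans (cong (fun (β.τ Y)) (α.τ-σ f x))
        (trans (β.τ-σ (α.τ Y ∘P f) (fun (α.τ X) x))
               (R.σ-cong {f = β.τ Y ∘P (α.τ Y ∘P f)}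
                         {g = (β.τ Y ∘P α.τ Y) ∘P f} (λ _ → refl)
                         (fun (β.τ X) (fun (α.τ X) x))))
  ; τ-η = λ X x → trans (cong (fun (β.τ X)) (α.τ-η X x)) (β.τ-η X x)
  }
  where module α = ΔMonadHom α
        module β = ΔMonadHom β
        module R = ΔMonad R

ΔE : EndoMonad → ΔMonad
ΔE Q = record
  { T = λ X → Δ (Q.T X)
  ; η = Δ₁ Q.η
  ; σ = λ f → Δ₁ (Q.σ (a f))
  ; σ-cong = λ p → Q.σ-cong p
  ; σ-η = λ f → Q.σ-η (a f)
  ; η-σ = Q.η-σ
  ; σ-σ = λ f g → Q.σ-σ (a f) (a g)
  }
  where module Q = EndoMonad Q

bar : ΔMonad → EndoMonad
bar P = record
  { T = λ X → U (P.T X)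
  ; η = fun P.η
  ; σ = λ f → fun (P.σ (a⁻¹ f))
  ; σ-cong = λ p → P.σ-cong p
  ; σ-η = λ f → P.σ-η (a⁻¹ f)
  ; η-σ = λ x → trans (P.σ-cong (λ _ → refl) x) (P.η-σ x)
  ; σ-σ = λ f g x → trans (P.σ-σ (a⁻¹ f) (a⁻¹ g) x) (P.σ-cong (λ _ → refl) x)
  }
  where module P = ΔMonad P

ΔHom : ∀ {P Q} → EndoHom P Q → ΔMonadHom (ΔE P) (ΔE Q)
ΔHom α = record
  { τ = λ X → Δ₁ (α.τ X)
  ; τ-σ = λ f → α.τ-σ (a f)
  ; τ-η = α.τ-η
  }
  where module α = EndoHom α

barHom : ∀ {P Q} → ΔMonadHom P Q → EndoHom (bar P) (bar Q)
barHom {P} {Q} β = record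
  { τ = λ X → fun (β.τ X)
  ; τ-σ = λ {X} {Y} f x →
      trans (β.τ-σ (a⁻¹ f) x) (Q.σ-cong (λ _ → refl) (fun (β.τ X) x))
  ; τ-η = β.τ-η
  }
  where module β = ΔMonadHom β
        module Q = ΔMonad Q

-- A monotone map out of a discrete preorder is just a function, and the
-- adjunction bijection a is the identity on underlying functions.  Hence
-- transposition leaves the components of a monad morphism unchanged, and the
-- morphism laws transfer because the substitutions of ΔE P and bar Q are built
-- from the same underlying functions: they differ only in monotonicity proofs,
-- which σ-cong ignores.
module Submission where

open import Defs
open import Data.Product using (Σ; _×_; _,_)
open import Relation.Binary.PropositionalEquality using (refl; trans)

module _ {P : EndoMonad} {Q : ΔMonad} where
  private
    module Q = ΔMonad Q

  toBarHom : ΔMonadHom (ΔE P) Q → EndoHom P (bar Q)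
  toBarHom t = record
    { τ   = λ X → fun (t.τ X)
    ; τ-σ = λ {X} f x →
        trans (t.τ-σ (Δ₁ f) x) (Q.σ-cong (λ _ → refl) (fun (t.τ X) x))
    ; τ-η = t.τ-η
    }
    where module t = ΔMonadHom t

  fromBarHom : EndoHom P (bar Q) → ΔMonadHom (ΔE P) Q
  fromBarHom t = record
    { τ   = λ X → a⁻¹ (t.τ X)
    ; τ-σ = λ {X} f x →
        trans (t.τ-σ (fun f) x) (Q.σ-cong (λ _ → refl) (t.τ X x))
    ; τ-η = t.τ-η
    }
    where module t = EndoHom t

  toBarHom-cong : ∀ {t t′} → t ≈Δ t′ → toBarHom t ≈E toBarHom t′
  toBarHom-cong t≈t′ = t≈t′

  fromBarHom-cong : ∀ {t t′} → t ≈E t′ → fromBarHom t ≈Δ fromBarHom t′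
  fromBarHom-cong t≈t′ = t≈t′

  fromBarHom∘toBarHom : ∀ t → fromBarHom (toBarHom t) ≈Δ t
  fromBarHom∘toBarHom t X x = refl

  toBarHom∘fromBarHom : ∀ t → toBarHom (fromBarHom t) ≈E t
  toBarHom∘fromBarHom t X x = refl

toBarHom-natural : ∀ {P P′ Q Q′} (α : EndoHom P′ P) (β : ΔMonadHom Q Q′)
                   (t : ΔMonadHom (ΔE P) Q) →
                   toBarHom (β ∘Δ (t ∘Δ ΔHom α)) ≈E (barHom β ∘E (toBarHom t ∘E α))
toBarHom-natural α β t X x = refl

lemma1p6 :
    Σ (∀ P Q → ΔMonadHom (ΔE P) Q → EndoHom P (bar Q)) λ φ →
    Σ (∀ P Q → EndoHom P (bar Q) → ΔMonadHom (ΔE P) Q) λ ψ →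
      (∀ P Q (τ τ′ : ΔMonadHom (ΔE P) Q) → τ ≈Δ τ′ → φ P Q τ ≈E φ P Q τ′)
      × (∀ P Q (τ τ′ : EndoHom P (bar Q)) → τ ≈E τ′ → ψ P Q τ ≈Δ ψ P Q τ′)
      × (∀ P Q (τ : ΔMonadHom (ΔE P) Q) → ψ P Q (φ P Q τ) ≈Δ τ)
      × (∀ P Q (τ : EndoHom P (bar Q)) → φ P Q (ψ P Q τ) ≈E τ)
      × (∀ P P′ Q Q′ (α : EndoHom P′ P) (β : ΔMonadHom Q Q′)
           (τ : ΔMonadHom (ΔE P) Q) →
           φ P′ Q′ (β ∘Δ (τ ∘Δ ΔHom α)) ≈E (barHom β ∘E (φ P Q τ ∘E α)))
lemma1p6 =
    (λ P Q → toBarHom {P} {Q})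
  , (λ P Q → fromBarHom {P} {Q})
  , (λ P Q t t′ → toBarHom-cong {P} {Q} {t} {t′})
  , (λ P Q t t′ → fromBarHom-cong {P} {Q} {t} {t′})
  , (λ P Q → fromBarHom∘toBarHom {P} {Q})
  , (λ P Q → toBarHom∘fromBarHom {P} {Q})
  , (λ P P′ Q Q′ → toBarHom-natural {P} {P′} {Q} {Q′})
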